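{- Let $f\colon \mathbb{Z}_2^n \to \mathbb{Z}_2^n$ be a Boolean map, and for $\mathbf{y}\in\mathbb{Z}_2^n$ let $A_{\mathbf y}=\{\mathbf x\in\mathbb{Z}_2^n : f(\mathbf x)=\mathbf y\}$. Let $d=\max_{\mathbf y\in\mathbb{Z}_2^n}|A_{\mathbf y}|$. Then for every integer $q\ge 0$ with $q<\lceil \log_2 d\rceil$ there is no reversible circuit with $n+q$ inputs consisting of NOT, CNOT and 2-CNOT gates that implements $f$ with $q$ additional inputs.
   Context: For $m\ge 1$, a $k$-CNOT gate on $m$ lines, with distinct control indices $i_1,\dots,i_k$ and a target index $j\notin\{i_1,\dots,i_k\}$, is the map $\mathbb{Z}_2^m\to\mathbb{Z}_2^m$, $\langle x_1,\dots,x_m\rangle\mapsto\langle x_1,\dots,x_j\oplus x_{i_1}\wedge\dots\wedge x_{i_k},\dots,x_m\rangle$ (only coordinate $j$ changes). NOT, CNOT and 2-CNOT are the cases $k=0,1,2$. A reversible circuit on $m$ lines is a finite sequence of such gates; it computes the composition $g\colon\mathbb{Z}_2^m\to\mathbb{Z}_2^m$ of its gates, and its complexity is the number of gates. A reversible circuit with $n+q$ inputs implements $f\colon\mathbb{Z}_2^n\to\mathbb{Z}_2^n$ with $q$ additional inputs if the map $g$ it computes satisfies $\psi_{n+q,n}(g(\phi_{n,n+q}(\mathbf x)))=f(\mathbf x)$ for all $\mathbf x\in\mathbb{Z}_2^n$, where $\phi_{n,n+q}(\langle x_1,\dots,x_n\rangle)=\langle x_1,\dots,x_n,0,\dots,0\rangle$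 (the last $q$ inputs are set to $0$) and $\psi_{n+q,n}(\langle x_1,\dots,x_{n+q}\rangle)=\langle x_1,\dots,x_n\rangle$ (only the first $n$ outputs are read). -}

module Defs where

open import Data.Bool using (Bool; true; false; not; _∧_; _xor_; if_then_else_)
open import Data.Nat using (ℕ; zero; suc; _+_; _⊔_)
open import Data.Fin using (Fin; _≟_)
open import Data.Vec using (Vec; []; _∷_; lookup; updateAt; _++_; replicate; take)
open import Data.List using (List; []; _∷_; map; concatMap; length; filter; foldr)
open import Relation.Binary.PropositionalEquality using (_≡_)
open import Relation.Nullary using (¬_)
open import Data.Vec.Properties using (≡-dec)
import Data.Bool.Properties as BP

-- Z_2 is modelled by Bool, with ⊕ = xor and multiplication = ∧.
-- Z_2^m is modelled by Vec Bool m.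

data Gate (m : ℕ) : Set where
  NOT   : (j : Fin m) → Gate m
  CNOT  : (i j : Fin m) → ¬ i ≡ j → Gate m
  CCNOT : (i₁ i₂ j : Fin m) → ¬ i₁ ≡ i₂ → ¬ i₁ ≡ j → ¬ i₂ ≡ j → Gate m

flipBy : ∀ {m} → Fin m → Bool → Vec Bool m → Vec Bool m
flipBy j b x = updateAt x j (λ xj → xj xor b)

applyGate : ∀ {m} → Gate m → Vec Bool m → Vec Bool m
applyGate (NOT j) x = flipBy j true x
applyGate (CNOT i j _) x = flipBy j (lookup x i) x
applyGate (CCNOT i₁ i₂ j _ _ _) x = flipBy j (lookup x i₁ ∧ lookup x i₂) x

Circuit : ℕ → Set
Circuit m = List (Gate m)

run : ∀ {m} → Circuit m → Vec Bool m → Vec Bool m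
run [] x = x
run (g ∷ c) x = run c (applyGate g x)

φ : ∀ n q → Vec Bool n → Vec Bool (n + q)
φ n q x = x ++ replicate q false

ψ : ∀ n q → Vec Bool (n + q) → Vec Bool n
ψ n q y = take n y

Implements : ∀ n q → Circuit (n + q) → (Vec Bool n → Vec Bool n) → Set
Implements n q c f = ∀ (x : Vec Bool n) → ψ n q (run c (φ n q x)) ≡ f x

allVecs : (n : ℕ) → List (Vec Bool n)
allVecs zero = [] ∷ []
allVecs (suc n) = concatMap (λ v → (false ∷ v) ∷ (true ∷ v) ∷ []) (allVecs n)

fiberSize : ∀ {n} → (Vec Bool n → Vec Bool n) → Vec Bool n → ℕ
fiberSize {n} f y = length (filter (λ x → ≡-dec BP._≟_ (f x) y) (allVecs n))

maxFiber : ∀ {n} → (Vec Bool n → Vec Bool n) → ℕ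
maxFiber {n} f = foldr (λ y acc → fiberSize f y ⊔ acc) 0 (allVecs n)

-- Every gate is an involution, so a circuit computes a bijection of Z₂^(n+q).
-- On a fiber A_y the n read-out lines all show y, hence the remaining q lines
-- must already tell the inputs of A_y apart: |A_y| ≤ 2^q for every y, so
-- d ≤ 2^q and ⌈log₂ d⌉ ≤ q.
module Submission where

open import Defs
open import Data.Bool using (Bool; true; false; _xor_; _∧_)
open import Data.Bool.Properties using (_≟_; xor-assoc; xor-same; xor-identityʳ)
open import Data.Fin using (Fin; zero; suc)
open import Data.Fin.Properties using (injective⇒≤)
open import Data.List using (List; []; _∷_; length; lookup; filter; concatMap; foldr)
open import Data.List.Relation.Unary.All as All using (All; [] ; _∷_)
open import Data.List.Relation.Unary.Any as Any using (here; there)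
open import Data.List.Relation.Unary.Unique.Propositional using (Unique; []; _∷_)
open import Data.List.Relation.Unary.Unique.Propositional.Properties using (filter⁺)
open import Data.List.Membership.Propositional using (_∈_)
open import Data.List.Membership.Propositional.Properties
  using (∈-lookup; ∈-filter⁻; ∈-concatMap⁺; ∈-concatMap⁻)
open import Data.List.Membership.Setoid.Properties using (index-injective)
open import Data.Nat using (ℕ; zero; suc; _+_; _*_; _^_; _⊔_; _≤_; _<_; z≤n)
open import Data.Nat.Properties using (*-suc; ⊔-lub; <-irrefl; module ≤-Reasoning)
open import Data.Nat.Logarithm using (⌈log₂_⌉; ⌈log₂⌉-mono-≤; ⌈log₂2^n⌉≡n)
open import Data.Product using (proj₂)
open import Data.Empty using (⊥-elim)
open import Function using (_∘_)
open import Data.Vec as Vec using (Vec; _∷_; tail; drop; _++_)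
open import Data.Vec.Properties
  using (≡-dec; updateAt-updateAt-local; updateAt-id-local; lookup∘updateAt′;
         take++drop≡id; ++-injectiveˡ)
open import Level using (Level)
open import Relation.Nullary using (¬_; Dec)
open import Relation.Binary.PropositionalEquality
  using (_≡_; _≢_; refl; sym; trans; cong; cong₂; setoid; module ≡-Reasoning)

private
  variable
    a b : Level
    A : Set a
    B : Set b
    m n q : ℕ

xor-cancelʳ : ∀ x y → (x xor y) xor y ≡ x
xor-cancelʳ x y = begin
  (x xor y) xor y ≡⟨ xor-assoc x y y ⟩
  x xor (y xor y) ≡⟨ cong (x xor_) (xor-same y) ⟩
  x xor false     ≡⟨ xor-identityʳ x ⟩
  x               ∎
  where open ≡-Reasoning

Unique⇒lookup-injective : {xs : List A} → Unique xs →
                          ∀ {i j} → lookup xs i ≡ lookup xs j → i ≡ j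
Unique⇒lookup-injective (_ ∷ _)  {zero}  {zero}  _  = refl
Unique⇒lookup-injective (x≢ ∷ _) {zero}  {suc j} eq = ⊥-elim (All.lookup x≢ (∈-lookup j) eq)
Unique⇒lookup-injective (x≢ ∷ _) {suc i} {zero}  eq = ⊥-elim (All.lookup x≢ (∈-lookup i) (sym eq))
Unique⇒lookup-injective (_ ∷ u)  {suc i} {suc j} eq = cong suc (Unique⇒lookup-injective u eq)

injectiveOn⇒length-≤ : {xs : List A} {ys : List B} (g : A → B) → Unique xs →
                       (∀ {x x′} → x ∈ xs → x′ ∈ xs → g x ≡ g x′ → x ≡ x′) →
                       (∀ {x} → x ∈ xs → g x ∈ ys) →
                       length xs ≤ length ys
injectiveOn⇒length-≤ {xs = xs} {ys} g unique injectiveOn into = injective⇒≤ injective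
  where
  position : Fin (length xs) → Fin (length ys)
  position i = Any.index (into (∈-lookup i))

  injective : ∀ {i j} → position i ≡ position j → i ≡ j
  injective {i} {j} eq =
    Unique⇒lookup-injective unique
      (injectiveOn (∈-lookup i) (∈-lookup j)
        (index-injective (setoid _) (into (∈-lookup i)) (into (∈-lookup j)) eq))

extensions : Vec Bool n → List (Vec Bool (suc n))
extensions v = (false ∷ v) ∷ (true ∷ v) ∷ []

∈-extensions⁺ : ∀ x {v : Vec Bool n} {vs} → v ∈ vs → (x ∷ v) ∈ concatMap extensions vs
∈-extensions⁺ x = ∈-concatMap⁺ extensions ∘ Any.map (λ { refl → ∷-∈-extensions x })
  where
  ∷-∈-extensions : ∀ x {v : Vec Bool n} → (x ∷ v) ∈ extensions v
  ∷-∈-extensions false = here refl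
  ∷-∈-extensions true  = there (here refl)

∈-extensions⁻ : {vs : List (Vec Bool n)} {w : Vec Bool (suc n)} →
                w ∈ concatMap extensions vs → tail w ∈ vs
∈-extensions⁻ = Any.map tail-∈-extensions ∘ ∈-concatMap⁻ extensions
  where
  tail-∈-extensions : ∀ {v : Vec Bool n} {w} → w ∈ extensions v → tail w ≡ v
  tail-∈-extensions (here refl)         = refl
  tail-∈-extensions (there (here refl)) = refl

length-extensions : (vs : List (Vec Bool n)) → length (concatMap extensions vs) ≡ 2 * length vs
length-extensions []       = refl
length-extensions (v ∷ vs) =
  trans (cong (2 +_) (length-extensions vs)) (sym (*-suc 2 (length vs)))

Unique-extensions : {vs : List (Vec Bool n)} → Unique vs → Unique (concatMap extensions vs)
Unique-extensions []               = []
Unique-extensions {vs = v ∷ vs} (v∉vs ∷ unique) =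
  ((λ ()) ∷ fresh false) ∷ fresh true ∷ Unique-extensions unique
  where
  fresh : ∀ x → All (x ∷ v ≢_) (concatMap extensions vs)
  fresh x = All.tabulate λ w∈ eq → All.lookup v∉vs (∈-extensions⁻ w∈) (cong tail eq)

∈-allVecs : (v : Vec Bool n) → v ∈ allVecs n
∈-allVecs Vec.[]  = here refl
∈-allVecs (x ∷ v) = ∈-extensions⁺ x (∈-allVecs v)

Unique-allVecs : ∀ n → Unique (allVecs n)
Unique-allVecs zero    = [] ∷ []
Unique-allVecs (suc n) = Unique-extensions (Unique-allVecs n)

length-allVecs : ∀ n → length (allVecs n) ≡ 2 ^ n
length-allVecs zero    = refl
length-allVecs (suc n) = trans (length-extensions (allVecs n)) (cong (2 *_) (length-allVecs n))

fiberSize-≤ : (f : Vec Bool n → Vec Bool n) (y : Vec Bool n) (g : Vec Bool n → Vec Bool q) →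
              (∀ {x x′} → f x ≡ y → f x′ ≡ y → g x ≡ g x′ → x ≡ x′) →
              fiberSize f y ≤ 2 ^ q
fiberSize-≤ {n} {q} f y g separates = begin
  fiberSize f y       ≤⟨ injectiveOn⇒length-≤ g (filter⁺ inFiber? (Unique-allVecs n))
                           (λ x∈ x′∈ → separates (inFiber x∈) (inFiber x′∈))
                           (λ _ → ∈-allVecs _) ⟩
  length (allVecs q)  ≡⟨ length-allVecs q ⟩
  2 ^ q               ∎
  where
  open ≤-Reasoning
  inFiber? : (x : Vec Bool n) → Dec (f x ≡ y)
  inFiber? x = ≡-dec _≟_ (f x) y
  inFiber : ∀ {x} → x ∈ filter inFiber? (allVecs n) → f x ≡ y
  inFiber = proj₂ ∘ ∈-filter⁻ inFiber? {xs = allVecs n}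

maxFiber-≤ : ∀ {B} (f : Vec Bool n → Vec Bool n) → (∀ y → fiberSize f y ≤ B) → maxFiber f ≤ B
maxFiber-≤ {n} {B} f fiber≤ = go (allVecs n)
  where
  go : (ys : List (Vec Bool n)) → foldr (λ y acc → fiberSize f y ⊔ acc) 0 ys ≤ B
  go []       = z≤n
  go (y ∷ ys) = ⊔-lub (fiber≤ y) (go ys)

flipBy-flipBy : ∀ (j : Fin m) {b b′} (x : Vec Bool m) → b′ ≡ b →
                flipBy j b′ (flipBy j b x) ≡ x
flipBy-flipBy j x refl =
  trans (updateAt-updateAt-local j {h = λ z → z} x (xor-cancelʳ (Vec.lookup x j) _))
        (updateAt-id-local j x refl)

lookup-flipBy : ∀ {i j : Fin m} {b} → i ≢ j → (x : Vec Bool m) →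
                Vec.lookup (flipBy j b x) i ≡ Vec.lookup x i
lookup-flipBy {i = i} {j} i≢j = lookup∘updateAt′ i j i≢j

applyGate-involutive : (g : Gate m) (x : Vec Bool m) → applyGate g (applyGate g x) ≡ x
applyGate-involutive (NOT j) x = flipBy-flipBy j x refl
applyGate-involutive (CNOT i j i≢j) x = flipBy-flipBy j x (lookup-flipBy i≢j x)
applyGate-involutive (CCNOT i₁ i₂ j _ i₁≢j i₂≢j) x =
  flipBy-flipBy j x (cong₂ _∧_ (lookup-flipBy i₁≢j x) (lookup-flipBy i₂≢j x))

run-injective : (c : Circuit m) {x y : Vec Bool m} → run c x ≡ run c y → x ≡ y
run-injective []      eq = eq
run-injective (g ∷ c) {x} {y} eq = begin
  x                             ≡⟨ sym (applyGate-involutive g x) ⟩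
  applyGate g (applyGate g x)   ≡⟨ cong (applyGate g) (run-injective c eq) ⟩
  applyGate g (applyGate g y)   ≡⟨ applyGate-involutive g y ⟩
  y                             ∎
  where open ≡-Reasoning

ancillae-separate-fibers : ∀ (c : Circuit (n + q)) {f} → Implements n q c f →
                           ∀ {x x′} → f x ≡ f x′ →
                           drop n (run c (φ n q x)) ≡ drop n (run c (φ n q x′)) → x ≡ x′
ancillae-separate-fibers {n} {q} c {f} implements {x} {x′} fx≡fx′ ancillae≡ =
  ++-injectiveˡ x x′ (run-injective c outputs≡)
  where
  open ≡-Reasoning
  outputs≡ : run c (φ n q x) ≡ run c (φ n q x′)
  outputs≡ = begin
    run c (φ n q x)                                          ≡⟨ take++drop≡id n _ ⟨
    ψ n q (run c (φ n q x)) ++ drop n (run c (φ n q x))     ≡⟨ cong₂ _++_ read-out≡ ancillae≡ ⟩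
    ψ n q (run c (φ n q x′)) ++ drop n (run c (φ n q x′))   ≡⟨ take++drop≡id n _ ⟩
    run c (φ n q x′)                                         ∎
    where
    read-out≡ : ψ n q (run c (φ n q x)) ≡ ψ n q (run c (φ n q x′))
    read-out≡ = trans (implements x) (trans fx≡fx′ (sym (implements x′)))

mainTheorem1 : ∀ (n : ℕ) (f : Vec Bool n → Vec Bool n) (q : ℕ) →
    q < ⌈log₂ maxFiber f ⌉ →
    ∀ (c : Circuit (n + q)) → ¬ Implements n q c f
mainTheorem1 n f q q<⌈log₂d⌉ c implements = <-irrefl refl (begin-strict
  q                     <⟨ q<⌈log₂d⌉ ⟩
  ⌈log₂ maxFiber f ⌉    ≤⟨ ⌈log₂⌉-mono-≤ (maxFiber-≤ f fiber≤2^q) ⟩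
  ⌈log₂ (2 ^ q) ⌉       ≡⟨ ⌈log₂2^n⌉≡n q ⟩
  q                     ∎)
  where
  open ≤-Reasoning
  fiber≤2^q : ∀ y → fiberSize f y ≤ 2 ^ q
  fiber≤2^q y = fiberSize-≤ f y (λ x → drop n (run c (φ n q x)))
    (λ fx≡y fx′≡y → ancillae-separate-fibers c implements (trans fx≡y (sym fx′≡y)))
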